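{- Let $G$ be a graph, let $t\geq 0$ be an integer, and let $H$ be the $t$-core of $G$. Suppose $H$ has maximum edge multiplicity at most $t+1$, and let $B$ be the underlying simple graph of the edges of $H$ of multiplicity exactly $t+1$. If $B$ has a full $B$-queue, then $\operatorname{cfan}(H)\leq t$.
   Context: A graph may have parallel edges but no loops. For a graph $J$ and vertices $x,y$, $\mu_J(x,y)$ is the number of edges of $J$ joining $x,y$; $\mu_J(v)=\max_u\mu_J(v,u)$; $d_J(v)$ is the degree of $v$ counting parallel edges; $N_J(x)$ is the neighbourhood of $x$; $\Delta(G)$ is the maximum degree. A subgraph may contain only some of the parallel copies of an edge. The $t$-core of $G$ is the subgraph induced by the vertices $v$ with $d_G(v)+\mu_G(v)>\Delta(G)+t$. Cfan number: for a graph $H$, a subgraph $K\subseteq H$ and an ordered pair $(x,y)$ with $xy\in E(K)$, $\operatorname{cdeg}_{H,K}(x,y)$ is the smallest nonnegative integer $l$ such that for all $Z\subseteq N_K(x)$ with $y\in Z$, $\sum_{z\in Z}(d_K(z)-d_H(z)+\mu_K(x,z)-l)\leq 1$; $\operatorname{cfan}(H)=\max_{K\subseteq H,\,E(K)\neq\emptyset}\min\{\operatorname{cdeg}_{H,K}(x,y): xy\in E(K)\}$, with $\operatorname{cfan}(H)=0$ if $H$ is edgeless. For a simple graph $B$, a $B$-queue is a sequence of vertices $(u_1,\ldots,u_q)$ together with vertex subsets $(S_0,\ldots,S_q)$ such that $S_0=\emptyset$ and for all $i\in\{1,\ldots,q\}$: $S_i=N_B(u_i)\cup\{u_i\}\cup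 S_{i-1}$; $1\leq|S_i\setminus S_{i-1}|\leq 2$; $u_i\notin\{u_1,\ldots,u_{i-1}\}$; and $|S_i\setminus(S_{i-1}\cup\{u_i\})|\leq 1$. It is full if $S_q=V(B)$. -}

module Defs where

open import Data.Nat using (ℕ; zero; suc; _+_; _≤_; _<_; _⊔_; _<ᵇ_; _≡ᵇ_)
open import Data.Integer as ℤ using (ℤ; +_)
open import Data.Fin using (Fin; zero; suc; _≟_)
open import Data.Bool using (Bool; true; false; if_then_else_; _∧_; _∨_; not; T)
open import Data.List using (List; []; _∷_; length; take; lookup)
open import Data.Bool.ListAction using (any)
open import Data.List.Membership.Propositional using (_∈_)
open import Data.Product using (Σ; _×_; ∃; ∃-syntax)
open import Relation.Binary.PropositionalEquality using (_≡_)
open import Relation.Nullary using (¬_; Dec; yes; no)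
open import Relation.Nullary.Decidable using (⌊_⌋)

sumFin : ∀ {n} → (Fin n → ℕ) → ℕ
sumFin {zero}  f = 0
sumFin {suc n} f = f zero + sumFin (λ i → f (suc i))

sumFinℤ : ∀ {n} → (Fin n → ℤ) → ℤ
sumFinℤ {zero}  f = + 0
sumFinℤ {suc n} f = f zero ℤ.+ sumFinℤ (λ i → f (suc i))

maxFin : ∀ {n} → (Fin n → ℕ) → ℕ
maxFin {zero}  f = 0
maxFin {suc n} f = f zero ⊔ maxFin (λ i → f (suc i))

VSet : ℕ → Set
VSet n = Fin n → Bool

count : ∀ {n} → VSet n → ℕ
count S = sumFin (λ v → if S v then 1 else 0)

record MGraph (n : ℕ) : Set where
  field
    μ      : Fin n → Fin n → ℕ
    μ-sym  : ∀ u v → μ u v ≡ μ v u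
    μ-loop : ∀ v → μ v v ≡ 0
open MGraph public

deg : ∀ {n} → MGraph n → Fin n → ℕ
deg J v = sumFin (λ u → μ J v u)

μmax : ∀ {n} → MGraph n → Fin n → ℕ
μmax J v = maxFin (λ u → μ J v u)

Δ : ∀ {n} → MGraph n → ℕ
Δ J = maxFin (λ v → deg J v)

maxMult : ∀ {n} → MGraph n → ℕ
maxMult J = maxFin (λ v → μmax J v)

_⊆G_ : ∀ {n} → MGraph n → MGraph n → Set
K ⊆G H = ∀ u v → μ K u v ≤ μ H u v

HasEdge : ∀ {n} → MGraph n → Set
HasEdge K = ∃[ x ] ∃[ y ] (0 < μ K x y)

-- The t-core is
-- represented on the same vertex set Fin n: it keeps exactly the edges
-- of G between core vertices (vertices outside the core become
-- isolated, which does not affect any edge-based notion below).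

inCore : ∀ {n} → MGraph n → ℕ → Fin n → Bool
inCore G t v = (Δ G + t) <ᵇ (deg G v + μmax G v)

core : ∀ {n} → MGraph n → ℕ → MGraph n
core {n} G t = record { μ = m ; μ-sym = sy ; μ-loop = lp }
  where
  m : Fin n → Fin n → ℕ
  m u v = if inCore G t u ∧ inCore G t v then μ G u v else 0
  open import Data.Bool.Properties using (∧-comm)
  open import Relation.Binary.PropositionalEquality using (refl; cong₂)
  sy : ∀ u v → m u v ≡ m v u
  sy u v with inCore G t u | inCore G t v
  ... | true  | true  = μ-sym G u v
  ... | true  | false = refl
  ... | false | true  = refl
  ... | false | false = refl
  lp : ∀ v → m v v ≡ 0
  lp v with inCore G t v
  ... | true  = μ-loop G v
  ... | false = refl

CdegCond : ∀ {n} → MGraph n → MGraph n → Fin n → Fin n → ℕ → Set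
CdegCond {n} H K x y l =
  (Z : VSet n) → (∀ z → T (Z z) → 0 < μ K x z) → T (Z y) →
  sumFinℤ (λ z → if Z z
                   then ((((+ deg K z) ℤ.- (+ deg H z)) ℤ.+ (+ μ K x z)) ℤ.- (+ l))
                   else + 0)
    ℤ.≤ + 1

IsCdeg : ∀ {n} → MGraph n → MGraph n → Fin n → Fin n → ℕ → Set
IsCdeg H K x y l = CdegCond H K x y l × (∀ l' → l' < l → ¬ CdegCond H K x y l')

-- cfan(H) ≤ t : for every subgraph K with at least one edge, the minimum
-- over edges xy of K of cdeg_{H,K}(x,y) is at most t
-- (for edgeless H, cfan(H) = 0 ≤ t and the condition is vacuous).
CfanLE : ∀ {n} → MGraph n → ℕ → Set
CfanLE H t =
  (K : MGraph _) → K ⊆G H → HasEdge K →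
  ∃[ x ] ∃[ y ] (0 < μ K x y × ∃[ l ] (IsCdeg H K x y l × l ≤ t))

adjB : ∀ {n} → MGraph n → ℕ → Fin n → Fin n → Bool
adjB H t u v = μ H u v ≡ᵇ suc t

inVB : ∀ {n} → MGraph n → ℕ → Fin n → Bool
inVB {n} H t v = any (λ u → adjB H t v u) (Data.List.tabulate {n = n} (λ i → i))
  where import Data.List

closedNbhd : ∀ {n} → MGraph n → ℕ → Fin n → VSet n
closedNbhd H t u v = adjB H t u v ∨ ⌊ u ≟ v ⌋

Sset : ∀ {n} → MGraph n → ℕ → List (Fin n) → VSet n
Sset H t us v = any (λ u → closedNbhd H t u v) us

-- conditions of a B-queue at step i (0-based index into us),
-- with S_{i-1} = Sset of the first i vertices, S_i = S_{i-1} ∪ N_B[u_i]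
record QueueStep {n} (H : MGraph n) (t : ℕ) (us : List (Fin n)) (i : Fin (length us)) : Set where
  prev : List (Fin n)
  prev = take (Data.Fin.toℕ i) us
  u : Fin n
  u = lookup us i
  new : VSet n
  new v = closedNbhd H t u v ∧ not (Sset H t prev v)
  field
    u∈VB     : T (inVB H t u)
    new≥1    : 1 ≤ count new
    new≤2    : count new ≤ 2
    u-fresh  : ¬ (u ∈ prev)
    newOther : count (λ v → new v ∧ not ⌊ u ≟ v ⌋) ≤ 1

IsBQueue : ∀ {n} → MGraph n → ℕ → List (Fin n) → Set
IsBQueue H t us = ∀ i → QueueStep H t us i

IsFullBQueue : ∀ {n} → MGraph n → ℕ → List (Fin n) → Set
IsFullBQueue H t us = IsBQueue H t us × (∀ v → Sset H t us v ≡ inVB H t v)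

-- Call z tight for x if d_K(z) = d_H(z) and μ_K(x,z) = t+1.  With l = t every
-- summand in the definition of cdeg is at most 1, and it is positive only at
-- tight vertices (d_K ≤ d_H and μ_K ≤ μ_H ≤ t+1).  So it suffices to find an
-- edge xy of K such that x has at most one tight vertex.  Every tight vertex is
-- saturated (d_K = d_H) and lies in V(B).  If there is no such vertex any edge
-- works; otherwise let u_i be the first vertex of the queue whose closed
-- B-neighbourhood contains one.  Saturation makes the B-edges at that vertex
-- edges of K, so u_i is incident with an edge of K, and the tight vertices of
-- u_i are B-neighbours of u_i outside S_{i-1}, of which the queue allows at
-- most one.
module Submission where

open import Defs
open import Data.Nat using (ℕ; zero; suc; _+_; _∸_; _≤_; _<_; z≤n; s≤s; _<?_)
open import Data.Nat.Properties
  using (≤-refl; ≤-trans; ≤-reflexive; ≤-antisym; ≤-pred; <⇒≢; ≤∧≢⇒<; +-mono-≤;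
         +-monoʳ-≤; +-mono-<-≤; +-mono-≤-<; +-suc; m≤n+m; m+n∸n≡m;
         m≤m⊔n; m≤n⇒m≤o⊔n; ≡ᵇ⇒≡; ≡⇒≡ᵇ)
  renaming (_≟_ to _≟ℕ_)
open import Data.Integer as ℤ using (ℤ; +_; +≤+; _⊖_)
import Data.Integer.Properties as ℤₚ
open import Data.Integer.Tactic.RingSolver using (solve-∀)
open import Data.Fin using (Fin; zero; suc; _≟_; toℕ; fromℕ; fromℕ<)
open import Data.Fin.Properties
  using (any?; all?; ¬∀⟶∃¬-smallest; toℕ≤pred[n]; toℕ-fromℕ; toℕ-fromℕ<; toℕ-inject)
open import Data.Fin.Subset.Properties using (anySubset?)
open import Data.Vec using (lookup; tabulate)
open import Data.Vec.Properties using (lookup∘tabulate)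
open import Data.Bool using (Bool; true; false; T; _∧_; not; if_then_else_)
open import Data.Bool.Properties using (T-∧; T-∨)
open import Data.List using (List; _∷_; take; length)
import Data.List as List
open import Data.List.Relation.Unary.Any using (Any; here; there)
import Data.List.Relation.Unary.Any as Any
open import Data.List.Relation.Unary.Any.Properties using (any⁺; any⁻; tabulate⁺; tabulate⁻)
open import Data.List.Membership.Propositional using (_∈_; find)
open import Data.Product using (Σ; _×_; _,_; proj₂; ∃-syntax)
open import Data.Sum using (inj₁; inj₂)
open import Data.Empty using (⊥-elim)
open import Data.Unit using (tt)
open import Function.Bundles using (Equivalence)
open import Relation.Nullary using (¬_; Dec; yes; no; contradiction)
open import Relation.Nullary.Decidable
  using (⌊_⌋; toWitness; fromWitnessFalse; decidable-stable; ¬?; _→-dec_; _×-dec_; T?)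
open import Relation.Binary.PropositionalEquality using (_≡_; _≢_; refl; sym; trans; cong; cong₂; subst)

open Equivalence using (to; from)

¬T⇒T-not : ∀ {b} → ¬ T b → T (not b)
¬T⇒T-not {true}  ¬t = contradiction tt ¬t
¬T⇒T-not {false} _  = tt

sumFin-mono : ∀ {n} {f g : Fin n → ℕ} → (∀ i → f i ≤ g i) → sumFin f ≤ sumFin g
sumFin-mono {zero}  f≤g = z≤n
sumFin-mono {suc n} f≤g = +-mono-≤ (f≤g zero) (sumFin-mono (λ i → f≤g (suc i)))

sumFin-mono-< : ∀ {n} {f g : Fin n → ℕ} → (∀ i → f i ≤ g i) →
                ∀ j → f j < g j → sumFin f < sumFin g
sumFin-mono-< f≤g zero    fj<gj = +-mono-<-≤ fj<gj (sumFin-mono (λ i → f≤g (suc i)))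
sumFin-mono-< f≤g (suc j) fj<gj = +-mono-≤-< (f≤g zero) (sumFin-mono-< (λ i → f≤g (suc i)) j fj<gj)

sumFin-≡⇒pointwise-≡ : ∀ {n} {f g : Fin n → ℕ} → (∀ i → f i ≤ g i) →
                       sumFin f ≡ sumFin g → ∀ i → f i ≡ g i
sumFin-≡⇒pointwise-≡ {f = f} {g} f≤g Σf≡Σg i with f i ≟ℕ g i
... | yes fi≡gi = fi≡gi
... | no  fi≢gi = contradiction Σf≡Σg (<⇒≢ (sumFin-mono-< f≤g i (≤∧≢⇒< (f≤g i) fi≢gi)))

maxFin-upper : ∀ {n} (f : Fin n → ℕ) i → f i ≤ maxFin f
maxFin-upper f zero    = m≤m⊔n _ _
maxFin-upper f (suc i) = m≤n⇒m≤o⊔n (f zero) (maxFin-upper (λ j → f (suc j)) i)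

μ≤maxMult : ∀ {n} (H : MGraph n) u v → μ H u v ≤ maxMult H
μ≤maxMult H u v = ≤-trans (maxFin-upper (μ H u) v) (maxFin-upper (μmax H) u)

sumFinℤ-cong : ∀ {n} {f g : Fin n → ℤ} → (∀ i → f i ≡ g i) → sumFinℤ f ≡ sumFinℤ g
sumFinℤ-cong {zero}  f≗g = refl
sumFinℤ-cong {suc n} f≗g = cong₂ ℤ._+_ (f≗g zero) (sumFinℤ-cong (λ i → f≗g (suc i)))

sumFinℤ-≤-sumFin : ∀ {n} {f : Fin n → ℤ} {g : Fin n → ℕ} →
                   (∀ i → f i ℤ.≤ + g i) → sumFinℤ f ℤ.≤ + sumFin g
sumFinℤ-≤-sumFin {zero}  f≤g = ℤₚ.≤-refl
sumFinℤ-≤-sumFin {suc n} f≤g = ℤₚ.+-mono-≤ (f≤g zero) (sumFinℤ-≤-sumFin (λ i → f≤g (suc i)))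

count-mono : ∀ {n} {S S′ : VSet n} → (∀ v → T (S v) → T (S′ v)) → count S ≤ count S′
count-mono {S = S} {S′} S⊆S′ = sumFin-mono (λ v → indicator-mono (S v) (S′ v) (S⊆S′ v))
  where
  indicator-mono : ∀ a b → (T a → T b) → (if a then 1 else 0) ≤ (if b then 1 else 0)
  indicator-mono true  true  _   = ≤-refl
  indicator-mono true  false a⇒b = ⊥-elim (a⇒b tt)
  indicator-mono false _     _   = z≤n

count-empty : ∀ {n} {S : VSet n} → (∀ v → ¬ T (S v)) → count S ≡ 0
count-empty {zero}          _     = refl
count-empty {suc n} {S} S∅ with S zero | S∅ zero
... | true  | ¬s₀ = contradiction tt ¬s₀
... | false | _   = count-empty (λ v → S∅ (suc v))

IsLeast : (ℕ → Set) → ℕ → Set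
IsLeast P l = P l × (∀ l′ → l′ < l → ¬ P l′)

least-≤ : {P : ℕ → Set} → (∀ l → Dec (P l)) → ∀ {m} → P m → ∃[ l ] (IsLeast P l × l ≤ m)
least-≤ {P} P? {m} Pm
  with ¬∀⟶∃¬-smallest (suc m) (λ i → ¬ P (toℕ i)) (λ i → ¬? (P? (toℕ i)))
         (λ none → none (fromℕ m) (subst P (sym (toℕ-fromℕ m)) Pm))
... | i , ¬¬Pi , noneBelow = toℕ i , (decidable-stable (P? _) ¬¬Pi , minimal) , toℕ≤pred[n] i
  where
  minimal : ∀ l → l < toℕ i → ¬ P l
  minimal l l<i = subst (λ k → ¬ P k) (trans (toℕ-inject (fromℕ< l<i)) (toℕ-fromℕ< l<i))
                    (noneBelow (fromℕ< l<i))

all-VSet? : ∀ {n} {P : VSet n → Set} → (∀ {Z Z′} → (∀ i → Z i ≡ Z′ i) → P Z → P Z′) →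
            (∀ Z → Dec (P Z)) → Dec (∀ Z → P Z)
all-VSet? {n} {P} resp P? with anySubset? {P = λ s → ¬ P (lookup s)} (λ s → ¬? (P? (lookup s)))
... | yes (s , ¬Ps) = no (λ all → ¬Ps (all (lookup s)))
... | no ¬∃         = yes λ Z → resp (lookup∘tabulate Z)
                                  (decidable-stable (P? _) (λ ¬PZ → ¬∃ (tabulate Z , ¬PZ)))

cdegCond? : ∀ {n} (H K : MGraph n) x y l → Dec (CdegCond H K x y l)
cdegCond? {n} H K x y l = all-VSet? resp Cond?
  where
  term : Fin n → ℤ
  term z = (((+ deg K z) ℤ.- (+ deg H z)) ℤ.+ (+ μ K x z)) ℤ.- (+ l)
  sumOver : VSet n → ℤ
  sumOver Z = sumFinℤ (λ z → if Z z then term z else + 0)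
  Cond : VSet n → Set
  Cond Z = (∀ z → T (Z z) → 0 < μ K x z) → T (Z y) → sumOver Z ℤ.≤ + 1
  resp : ∀ {Z Z′} → (∀ i → Z i ≡ Z′ i) → Cond Z → Cond Z′
  resp Z≗Z′ cond Z′⊆N y∈Z′ =
    subst (ℤ._≤ + 1) (sumFinℤ-cong (λ z → cong (if_then term z else + 0) (Z≗Z′ z)))
      (cond (λ z z∈Z → Z′⊆N z (subst T (Z≗Z′ z) z∈Z)) (subst T (sym (Z≗Z′ y)) y∈Z′))
  Cond? : ∀ Z → Dec (Cond Z)
  Cond? Z = all? (λ z → T? (Z z) →-dec (0 <? μ K x z)) →-dec (T? (Z y) →-dec (sumOver Z ℤ.≤? + 1))

firstIndex : ∀ {A : Set} {P : A → Set} → (∀ a → Dec (P a)) → (xs : List A) → Any P xs →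
             Σ (Fin (length xs)) λ i → P (List.lookup xs i) × (∀ {a} → a ∈ take (toℕ i) xs → ¬ P a)
firstIndex P? (x ∷ xs) Pxs with P? x
... | yes Px = zero , Px , λ ()
firstIndex P? (x ∷ xs) (here Px)   | no ¬Px = contradiction Px ¬Px
firstIndex P? (x ∷ xs) (there Pxs) | no ¬Px with firstIndex P? xs Pxs
... | i , Pi , before = suc i , Pi , λ { (here refl) → ¬Px ; (there a∈) → before a∈ }

-- The hypothesis is the conclusion with every subtraction moved across, so it
-- is a plain inequality of naturals.
cdegTerm-≤ : ∀ a b m l c → a + m ≤ c + (b + l) → ((+ a ℤ.- + b) ℤ.+ + m) ℤ.- + l ℤ.≤ + c
cdegTerm-≤ a b m l c h = begin
  ((+ a ℤ.- + b) ℤ.+ + m) ℤ.- + l  ≡⟨ regroup (+ a) (+ b) (+ m) (+ l) ⟩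
  + (a + m) ℤ.- + (b + l)          ≡⟨ ℤₚ.[+m]-[+n]≡m⊖n (a + m) (b + l) ⟩
  (a + m) ⊖ (b + l)                ≤⟨ ℤₚ.⊖-monoˡ-≤ (b + l) h ⟩
  (c + (b + l)) ⊖ (b + l)          ≡⟨ ℤₚ.⊖-≥ (m≤n+m (b + l) c) ⟩
  + (c + (b + l) ∸ (b + l))         ≡⟨ cong +_ (m+n∸n≡m c (b + l)) ⟩
  + c                              ∎
  where
  open ℤₚ.≤-Reasoning
  regroup : ∀ (a b m l : ℤ) → ((a ℤ.- b) ℤ.+ m) ℤ.- l ≡ (a ℤ.+ m) ℤ.- (b ℤ.+ l)
  regroup = solve-∀

slack-≤ : ∀ {a b m l} → a ≤ b → m ≤ suc l →
          a + m ≤ (if ⌊ (a ≟ℕ b) ×-dec (m ≟ℕ suc l) ⌋ then 1 else 0) + (b + l)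
slack-≤ {a} {b} {m} {l} a≤b m≤l+1 with a ≟ℕ b | m ≟ℕ suc l
... | yes refl | yes refl = ≤-reflexive (+-suc a l)
... | yes refl | no  m≢l+1 = +-monoʳ-≤ a (≤-pred (≤∧≢⇒< m≤l+1 m≢l+1))
... | no  a≢b  | _ = ≤-pred (≤-trans (+-mono-≤ (≤∧≢⇒< a≤b a≢b) m≤l+1) (≤-reflexive (+-suc b l)))

if-≤ : ∀ (b : Bool) {x : ℤ} {c : ℕ} → x ℤ.≤ + c → (if b then x else + 0) ℤ.≤ + c
if-≤ true  x≤c = x≤c
if-≤ false _   = +≤+ z≤n

module _ {n} (H : MGraph n) (t : ℕ) (maxMult≤ : maxMult H ≤ suc t) (K : MGraph n) (K⊆H : K ⊆G H) where

  μH≤ : ∀ u v → μ H u v ≤ suc t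
  μH≤ u v = ≤-trans (μ≤maxMult H u v) maxMult≤

  Saturated : Fin n → Set
  Saturated z = deg K z ≡ deg H z

  Tight : Fin n → Fin n → Set
  Tight x z = Saturated z × μ K x z ≡ suc t

  tight? : ∀ x z → Dec (Tight x z)
  tight? x z = (deg K z ≟ℕ deg H z) ×-dec (μ K x z ≟ℕ suc t)

  tightCount : Fin n → ℕ
  tightCount x = count (λ z → ⌊ tight? x z ⌋)

  cdegCond-tightCount : ∀ x y → tightCount x ≤ 1 → CdegCond H K x y t
  cdegCond-tightCount x y few Z _ _ = ℤₚ.≤-trans (sumFinℤ-≤-sumFin summand≤) (+≤+ few)
    where
    summand≤ : ∀ z → (if Z z then (((+ deg K z ℤ.- + deg H z) ℤ.+ + μ K x z) ℤ.- + t) else + 0)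
                       ℤ.≤ + (if ⌊ tight? x z ⌋ then 1 else 0)
    summand≤ z = if-≤ (Z z) (cdegTerm-≤ (deg K z) (deg H z) (μ K x z) t _
                   (slack-≤ (sumFin-mono (K⊆H z)) (≤-trans (K⊆H x z) (μH≤ x z))))

  saturated-μ : ∀ {z} → Saturated z → ∀ u → μ K z u ≡ μ H z u
  saturated-μ sat = sumFin-≡⇒pointwise-≡ (K⊆H _) sat

  heavy-μH : ∀ {x z} → μ K x z ≡ suc t → μ H x z ≡ suc t
  heavy-μH {x} {z} μK≡ = ≤-antisym (μH≤ x z) (subst (_≤ μ H x z) μK≡ (K⊆H x z))

  SaturatedInVB : Fin n → Set
  SaturatedInVB z = Saturated z × T (inVB H t z)

  inVB-intro : ∀ {v u} → μ H v u ≡ suc t → T (inVB H t v)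
  inVB-intro {u = u} μ≡ = any⁺ _ (tabulate⁺ u (≡⇒≡ᵇ _ _ μ≡))

  inVB-elim : ∀ {v} → T (inVB H t v) → ∃[ u ] μ H v u ≡ suc t
  inVB-elim v∈VB with tabulate⁻ (any⁻ _ _ v∈VB)
  ... | u , adj = u , ≡ᵇ⇒≡ _ _ adj

  tight⇒SaturatedInVB : ∀ {x z} → Tight x z → SaturatedInVB z
  tight⇒SaturatedInVB {x} {z} (sat , μK≡) = sat , inVB-intro (trans (μ-sym H z x) (heavy-μH μK≡))

  saturatedInVB? : ∀ z → Dec (SaturatedInVB z)
  saturatedInVB? z = (deg K z ≟ℕ deg H z) ×-dec T? (inVB H t z)

  TouchesSaturated : Fin n → Set
  TouchesSaturated u = ∃[ z ] (SaturatedInVB z × T (closedNbhd H t u z))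

  touchesSaturated? : ∀ u → Dec (TouchesSaturated u)
  touchesSaturated? u = any? (λ z → saturatedInVB? z ×-dec T? (closedNbhd H t u z))

  heavy⇒0< : ∀ {k} → k ≡ suc t → 0 < k
  heavy⇒0< refl = s≤s z≤n

  touchesSaturated⇒edge : ∀ {u} → TouchesSaturated u → ∃[ y ] 0 < μ K u y
  touchesSaturated⇒edge {u} (z , (sat , z∈VB) , z∈N[u]) with to T-∨ z∈N[u]
  ... | inj₁ uz∈B = z , heavy⇒0< (trans (μ-sym K u z) (trans (saturated-μ sat u)
                                   (trans (μ-sym H z u) (≡ᵇ⇒≡ _ _ uz∈B))))
  ... | inj₂ u≡z with inVB-elim z∈VB
  ...   | w , μzw≡ = w , subst (λ v → 0 < μ K v w) (sym (toWitness u≡z))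
                           (heavy⇒0< (trans (saturated-μ sat w) μzw≡))

  tight⇒newOther : ∀ us i → (∀ {a} → a ∈ take (toℕ i) us → ¬ TouchesSaturated a) →
    let u = List.lookup us i in ∀ v → T ⌊ tight? u v ⌋ →
    T ((closedNbhd H t u v ∧ not (Sset H t (take (toℕ i) us) v)) ∧ not ⌊ u ≟ v ⌋)
  tight⇒newOther us i noEarlierTouch v uv-tight =
    from T-∧ (from T-∧ (v∈N[u] , ¬T⇒T-not v∉S) , fromWitnessFalse u≢v)
    where
    u : Fin n
    u = List.lookup us i
    tight : Tight u v
    tight = toWitness uv-tight
    v∈N[u] : T (closedNbhd H t u v)
    v∈N[u] = from T-∨ (inj₁ (≡⇒≡ᵇ _ _ (heavy-μH (proj₂ tight))))
    v∉S : ¬ T (Sset H t (take (toℕ i) us) v)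
    v∉S v∈S with find (any⁻ _ _ v∈S)
    ... | a , a∈ , v∈N[a] = noEarlierTouch a∈ (v , tight⇒SaturatedInVB tight , v∈N[a])
    u≢v : u ≢ v
    u≢v refl with trans (sym (μ-loop K u)) (proj₂ tight)
    ... | ()

  fewTightEdge : HasEdge K → ∀ us → IsFullBQueue H t us →
                 ∃[ x ] ∃[ y ] (0 < μ K x y × tightCount x ≤ 1)
  fewTightEdge (a , b , ab) us (queue , full) with any? saturatedInVB?
  ... | no noneSat = a , b , ab , ≤-trans (≤-reflexive (count-empty noneTight)) z≤n
    where
    noneTight : ∀ z → ¬ T ⌊ tight? a z ⌋
    noneTight z az = noneSat (z , tight⇒SaturatedInVB (toWitness az))
  ... | yes (z , z-sat) with firstIndex touchesSaturated? us touching
    where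
    touching : Any TouchesSaturated us
    touching = Any.map (λ z∈N → z , z-sat , z∈N) (any⁻ _ us (subst T (sym (full z)) (proj₂ z-sat)))
  ...   | i , u-touches , noEarlierTouch =
    let y , uy = touchesSaturated⇒edge u-touches in
    List.lookup us i , y , uy ,
    ≤-trans (count-mono (tight⇒newOther us i noEarlierTouch)) (QueueStep.newOther (queue i))

theorem3p1 : ∀ {n} (G : MGraph n) (t : ℕ) →
    maxMult (core G t) ≤ suc t →
    ∃[ us ] IsFullBQueue (core G t) t us →
    CfanLE (core G t) t
theorem3p1 {n} G t maxMult≤ (us , fullQueue) K K⊆H hasEdge =
  let x , y , xy , few = fewTightEdge H t maxMult≤ K K⊆H hasEdge us fullQueue
      l , isCdeg , l≤t = least-≤ (cdegCond? H K x y) (cdegCond-tightCount H t maxMult≤ K K⊆H x y few)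
  in x , y , xy , l , isCdeg , l≤t
  where
  H : MGraph n
  H = core G t
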